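{- Let $(P,\leq,{}',0,1)$ be a strong generalized orthomodular poset and define, for all $x,y\in P$, $M(x,y):=L(U(x,y'),y)$ and $R(x,y):=LU(x',L(x,y))$. Then $(P,\leq,{}',M,R,0,1)$ is an operator residuated poset satisfying operator divisibility.
   Context: For a poset $(P,\leq)$ and $A\subseteq P$, $L(A)=\{x\in P\mid x\leq a\text{ for all }a\in A\}$ and $U(A)=\{x\in P\mid a\leq x\text{ for all }a\in A\}$; we write $L(a,b)=L(\{a,b\})$, $L(a,B)=L(\{a\}\cup B)$, $L(A,B)=L(A\cup B)$, $LU(A)=L(U(A))$, etc.; for sets $A,B$, $A\leq B$ means $a\leq b$ for all $a\in A,b\in B$ and $x\leq B$ means $\{x\}\leq B$. A unary operation $'$ on a poset is an antitone involution if $x''=x$ and $x\leq y$ implies $y'\leq x'$; on a bounded poset it is a complementation if $L(x,x')=\{0\}$ and $U(x,x')=\{1\}$. An orthoposet is a bounded poset $(P,\leq,{}',0,1)$ with an antitone involution $'$ which is a complementation. A strong generalized orthomodular poset is an orthoposet such that for all $x\in P$ and all $B\subseteq P$, $x\leq U(B)$ implies $U(B)=U(x,L(x',U(B)))$. An operator residuated poset is a tuple $(P,\leq,{}',M,R,0,1)$ where $(P,\leq,0,1)$ is a bounded poset, $'$ is a unary antitone operation on $P$, and $M,R:P^2\to 2^P$ satisfy for all $x,y,z\in P$: (i) $M(x,y)\subseteq L(z)$ if and only if $L(x)\subseteq R(y,z)$; (ii) $R(x,0)=L(x')$; (iii) $R(x,x'')=R(x'',x)=P$. It satisfies operator divisibility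 if $x\leq y$ implies $L(y,U(R(y,x)))=L(x)$ for all $x,y\in P$. -}

module Defs where

open import Level using (Level; suc)
open import Relation.Binary.Bundles using (Poset)
open import Relation.Unary using (Pred; _⊆_)
open import Data.Product using (_×_; _,_)
open import Data.Sum using (_⊎_)
open import Data.Unit.Polymorphic using (⊤)

-- Set-valued maps P² → 2^P are functions Carrier → Carrier → Subset.

module PosetNotions {ℓ : Level} (𝑷 : Poset ℓ ℓ ℓ) where
  open Poset 𝑷 public

  Subset : Set (suc ℓ)
  Subset = Pred Carrier ℓ

  _≐_ : Subset → Subset → Set ℓ
  A ≐ B = (A ⊆ B) × (B ⊆ A)

  sing : Carrier → Subset
  sing a x = x ≈ a

  pair : Carrier → Carrier → Subset
  pair a b x = (x ≈ a) ⊎ (x ≈ b)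

  _∪ˢ_ : Subset → Subset → Subset
  (A ∪ˢ B) x = A x ⊎ B x

  Full : Subset
  Full _ = ⊤

  L : Subset → Subset
  L A x = ∀ a → A a → x ≤ a

  U : Subset → Subset
  U A x = ∀ a → A a → a ≤ x

  _≤ₑ_ : Carrier → Subset → Set ℓ
  x ≤ₑ B = ∀ b → B b → x ≤ b

  IsAntitone : (Carrier → Carrier) → Set ℓ
  IsAntitone f = ∀ {x y} → x ≤ y → f y ≤ f x

  IsAntitoneInvolution : (Carrier → Carrier) → Set ℓ
  IsAntitoneInvolution f = (∀ x → f (f x) ≈ x) × IsAntitone f

  IsComplementation : (Carrier → Carrier) → Carrier → Carrier → Set ℓ
  IsComplementation f 0ₚ 1ₚ =
    (∀ x → L (pair x (f x)) ≐ sing 0ₚ) × (∀ x → U (pair x (f x)) ≐ sing 1ₚ)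

  IsBounded : Carrier → Carrier → Set ℓ
  IsBounded 0ₚ 1ₚ = (∀ x → 0ₚ ≤ x) × (∀ x → x ≤ 1ₚ)

  IsOrthoposet : (Carrier → Carrier) → Carrier → Carrier → Set ℓ
  IsOrthoposet f 0ₚ 1ₚ =
    IsBounded 0ₚ 1ₚ × IsAntitoneInvolution f × IsComplementation f 0ₚ 1ₚ

  IsStrongGOMP : (Carrier → Carrier) → Carrier → Carrier → Set (suc ℓ)
  IsStrongGOMP f 0ₚ 1ₚ =
    IsOrthoposet f 0ₚ 1ₚ ×
    (∀ (x : Carrier) (B : Subset) → x ≤ₑ U B →
       U B ≐ U (sing x ∪ˢ L (sing (f x) ∪ˢ U B)))

  IsOperatorResiduated : (Carrier → Carrier) →
    (Carrier → Carrier → Subset) → (Carrier → Carrier → Subset) →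
    Carrier → Carrier → Set ℓ
  IsOperatorResiduated f M R 0ₚ 1ₚ =
    IsBounded 0ₚ 1ₚ × IsAntitone f ×
    (∀ x y z → (M x y ⊆ L (sing z) → L (sing x) ⊆ R y z)
             × (L (sing x) ⊆ R y z → M x y ⊆ L (sing z))) ×
    (∀ x → R x 0ₚ ≐ L (sing (f x))) ×
    (∀ x → (R x (f (f x)) ≐ Full) × (R (f (f x)) x ≐ Full))

  OperatorDivisibility : (Carrier → Carrier → Subset) → Set ℓ
  OperatorDivisibility R =
    ∀ x y → x ≤ y → L (sing y ∪ˢ U (R y x)) ≐ L (sing x)

-- R(y, z) = LU(y', L(y, z)) is a lower set containing L(y, z), and all the
-- work lies in the cancellation property: an element below y that lies in
-- R(y, z) is below z.  Orthomodularity applied to B = {y', z'} gives it: the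
-- complement of such an element is an upper bound of {y'} ∪ L(y, U B), hence
-- of B.  The same law applied to B = {x, y'} shows that x ∈ R(y, z) as soon as
-- M(x, y) ⊆ L(z), which together with cancellation is residuation; divisibility
-- is cancellation for z = x ≤ y.

module Submission where

open import Defs
open import Level using (Level)
open import Relation.Binary.Bundles using (Poset)
open import Relation.Unary using (_⊆_)
open import Data.Product using (_×_; _,_; proj₁; proj₂)
open import Data.Sum using (inj₁; inj₂)
open import Data.Unit.Polymorphic using (tt)

module PosetResiduation {ℓ : Level} (𝑷 : Poset ℓ ℓ ℓ) where
  open PosetNotions 𝑷

  L-sing⁺ : ∀ {x a} → x ≤ a → L (sing a) x
  L-sing⁺ x≤a b b≈a = ≤-respʳ-≈ (Eq.sym b≈a) x≤a

  L-sing⁻ : ∀ {x a} → L (sing a) x → x ≤ a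
  L-sing⁻ h = h _ Eq.refl

  L-pair⁺ : ∀ {x a b} → x ≤ a → x ≤ b → L (pair a b) x
  L-pair⁺ x≤a x≤b c (inj₁ c≈a) = ≤-respʳ-≈ (Eq.sym c≈a) x≤a
  L-pair⁺ x≤a x≤b c (inj₂ c≈b) = ≤-respʳ-≈ (Eq.sym c≈b) x≤b

  U-pair⁺ : ∀ {x a b} → a ≤ x → b ≤ x → U (pair a b) x
  U-pair⁺ a≤x b≤x c (inj₁ c≈a) = ≤-respˡ-≈ (Eq.sym c≈a) a≤x
  U-pair⁺ a≤x b≤x c (inj₂ c≈b) = ≤-respˡ-≈ (Eq.sym c≈b) b≤x

  L-sing-∪⁺ : ∀ {x a A} → x ≤ a → L A x → L (sing a ∪ˢ A) x
  L-sing-∪⁺ x≤a lx c (inj₁ c≈a) = ≤-respʳ-≈ (Eq.sym c≈a) x≤a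
  L-sing-∪⁺ x≤a lx c (inj₂ c∈A) = lx c c∈A

  U-sing-∪⁺ : ∀ {x a A} → a ≤ x → U A x → U (sing a ∪ˢ A) x
  U-sing-∪⁺ a≤x ux c (inj₁ c≈a) = ≤-respˡ-≈ (Eq.sym c≈a) a≤x
  U-sing-∪⁺ a≤x ux c (inj₂ c∈A) = ux c c∈A

  L-downward : ∀ {A w x} → w ≤ x → L A x → L A w
  L-downward w≤x lx a a∈A = trans w≤x (lx a a∈A)

  ⊆LU : ∀ {A} → A ⊆ L (U A)
  ⊆LU a∈A u ua = ua _ a∈A

  LULU⊆LU : ∀ {A} → L (U (L (U A))) ⊆ L (U A)
  LULU⊆LU lulu u ua = lulu u (λ v lv → lv u ua)

  module Orthocomplement (_′ : Carrier → Carrier)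
    (′-involutive : ∀ x → (x ′) ′ ≈ x) (′-antitone : IsAntitone _′) where

    ′-swap : ∀ {a b} → a ≤ b ′ → b ≤ a ′
    ′-swap {b = b} a≤b′ = ≤-respˡ-≈ (′-involutive b) (′-antitone a≤b′)

    ′-reflect : ∀ {a b} → a ′ ≤ b ′ → b ≤ a
    ′-reflect {a} a′≤b′ = ≤-respʳ-≈ (′-involutive a) (′-swap a′≤b′)

  module StrongGOMP (_′ : Carrier → Carrier) (0ₚ 1ₚ : Carrier)
    (gomp : IsStrongGOMP _′ 0ₚ 1ₚ) where

    private
      bounded : IsBounded 0ₚ 1ₚ
      bounded = proj₁ (proj₁ gomp)

      involution : IsAntitoneInvolution _′
      involution = proj₁ (proj₂ (proj₁ gomp))

      complementation : IsComplementation _′ 0ₚ 1ₚ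
      complementation = proj₂ (proj₂ (proj₁ gomp))

    ′-antitone : IsAntitone _′
    ′-antitone = proj₂ involution

    open Orthocomplement _′ (proj₁ involution) ′-antitone

    M : Carrier → Carrier → Subset
    M x y = L (U (pair x (y ′)) ∪ˢ sing y)

    R : Carrier → Carrier → Subset
    R x y = L (U (sing (x ′) ∪ˢ L (pair x y)))

    orthomodular-U : ∀ {y B u} → B (y ′) → y ′ ≤ u →
                     (∀ a → a ≤ y → a ≤ₑ U B → a ≤ u) → U B u
    orthomodular-U {y} {B} {u} y′∈B y′≤u bounds =
      proj₂ (proj₂ gomp (y ′) B (λ b ub → ub (y ′) y′∈B)) (U-sing-∪⁺ y′≤u bounds′)
      where
      bounds′ : U (L (sing ((y ′) ′) ∪ˢ U B)) u
      bounds′ a la = bounds a (≤-respʳ-≈ (proj₁ involution y) (la _ (inj₁ Eq.refl)))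
                              (λ b ub → la b (inj₂ ub))

    L⊆R : ∀ {y z} → L (pair y z) ⊆ R y z
    L⊆R a∈L = ⊆LU (inj₂ a∈L)

    R-cancel : ∀ {w y z} → w ≤ y → R y z w → w ≤ z
    R-cancel {w} {y} {z} w≤y w∈R =
      ′-reflect (orthomodular-U (inj₁ Eq.refl) (′-antitone w≤y) below-w′ (z ′) (inj₂ Eq.refl))
      where
      below-w′ : ∀ a → a ≤ y → a ≤ₑ U (pair (y ′) (z ′)) → a ≤ w ′
      below-w′ a a≤y a≤U = ′-swap (w∈R (a ′) a′-bound)
        where
        a′-bound : U (sing (y ′) ∪ˢ L (pair y z)) (a ′)
        a′-bound = U-sing-∪⁺ (′-antitone a≤y) λ v v∈L →
          ′-swap (a≤U (v ′) (U-pair⁺ (′-antitone (v∈L y (inj₁ Eq.refl)))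
                                     (′-antitone (v∈L z (inj₂ Eq.refl)))))

    M⊆L⇒∈R : ∀ {x y z} → M x y ⊆ L (sing z) → R y z x
    M⊆L⇒∈R {x} {y} {z} M⊆L u u-bound =
      orthomodular-U (inj₂ Eq.refl) (u-bound (y ′) (inj₁ Eq.refl)) below-u x (inj₁ Eq.refl)
      where
      below-u : ∀ a → a ≤ y → a ≤ₑ U (pair x (y ′)) → a ≤ u
      below-u a a≤y a≤U = u-bound a (inj₂ (L-pair⁺ a≤y (L-sing⁻ (M⊆L a∈M))))
        where
        a∈M : M x y a
        a∈M c (inj₁ c∈U) = a≤U c c∈U
        a∈M c (inj₂ c≈y) = ≤-respʳ-≈ (Eq.sym c≈y) a≤y

    ∈R⇒M⊆L : ∀ {x y z} → R y z x → M x y ⊆ L (sing z)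
    ∈R⇒M⊆L {x} {y} {z} x∈R {w} w∈M = L-sing⁺ (R-cancel w≤y w∈R)
      where
      w≤y : w ≤ y
      w≤y = w∈M y (inj₂ Eq.refl)
      w∈R : R y z w
      w∈R u u-bound = w∈M u (inj₁ (U-pair⁺ (x∈R u u-bound) (u-bound (y ′) (inj₁ Eq.refl))))

    residuation : ∀ x y z → (M x y ⊆ L (sing z) → L (sing x) ⊆ R y z)
                          × (L (sing x) ⊆ R y z → M x y ⊆ L (sing z))
    residuation x y z =
        (λ M⊆L w∈L → L-downward (L-sing⁻ w∈L) (M⊆L⇒∈R M⊆L))
      , (λ L⊆R′ → ∈R⇒M⊆L (L⊆R′ (L-sing⁺ refl)))

    R-zero : ∀ x → R x 0ₚ ≐ L (sing (x ′))
    R-zero x = (λ w∈R → L-sing⁺ (w∈R (x ′) x′-bound))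
             , (λ w∈L u u-bound → trans (L-sing⁻ w∈L) (u-bound (x ′) (inj₁ Eq.refl)))
      where
      x′-bound : U (sing (x ′) ∪ˢ L (pair x 0ₚ)) (x ′)
      x′-bound = U-sing-∪⁺ refl λ a a∈L → trans (a∈L 0ₚ (inj₂ Eq.refl)) (proj₁ bounded (x ′))

    -- Every upper bound of {y', y} is 1 by complementation.
    R-full : ∀ {y z} → y ≤ z → R y z ≐ Full
    R-full {y} y≤z = (λ _ → tt) , λ {w} _ u u-bound →
      ≤-respʳ-≈ (Eq.sym (proj₁ (proj₂ complementation y) (U-pair⁺
        (u-bound y (inj₂ (L-pair⁺ refl y≤z))) (u-bound (y ′) (inj₁ Eq.refl)))))
        (proj₂ bounded w)

    isOperatorResiduated : IsOperatorResiduated _′ M R 0ₚ 1ₚ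
    isOperatorResiduated =
      bounded , ′-antitone , residuation , R-zero ,
      λ x → R-full (reflexive (Eq.sym (proj₁ involution x)))
          , R-full (reflexive (proj₁ involution x))

    divisibility-⊆ : ∀ {x y} → L (sing y ∪ˢ U (R y x)) ⊆ L (sing x)
    divisibility-⊆ {x} {y} w∈L =
      L-sing⁺ (R-cancel (w∈L y (inj₁ Eq.refl)) (LULU⊆LU λ u u∈U → w∈L u (inj₂ u∈U)))

    divisibility-⊇ : ∀ {x y} → x ≤ y → L (sing x) ⊆ L (sing y ∪ˢ U (R y x))
    divisibility-⊇ x≤y w∈L =
      L-downward (L-sing⁻ w∈L) (L-sing-∪⁺ x≤y (⊆LU (L⊆R (L-pair⁺ x≤y refl))))

    operatorDivisibility : OperatorDivisibility R
    operatorDivisibility x y x≤y = divisibility-⊆ , divisibility-⊇ x≤y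

mainTheorem3 : ∀ {ℓ : Level} (𝑷 : Poset ℓ ℓ ℓ) →
    let open PosetNotions 𝑷 in
    (_′ : Carrier → Carrier) (0ₚ 1ₚ : Carrier) →
    IsStrongGOMP _′ 0ₚ 1ₚ →
    let M : Carrier → Carrier → Subset
        M x y = L (U (pair x (y ′)) ∪ˢ sing y)
        R : Carrier → Carrier → Subset
        R x y = L (U (sing (x ′) ∪ˢ L (pair x y)))
    in IsOperatorResiduated _′ M R 0ₚ 1ₚ × OperatorDivisibility R
mainTheorem3 𝑷 _′ 0ₚ 1ₚ gomp =
  isOperatorResiduated , operatorDivisibility
  where open PosetResiduation.StrongGOMP 𝑷 _′ 0ₚ 1ₚ gomp
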